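{- Let $c$ be a basic command, $P,Q$ assertions, $\Gamma$ a resource context, $(s,h)\in\mathcal{S}$, $\rho$ a resource configuration and $A\subseteq\mathbf{Var}$ such that $\vdash^{SL}\{P\}c\{Q\}$ and $FV(P,c,Q)\subseteq A$. If $s,h\models P$ and no variable of $mod(c)$ belongs to $PV(\Gamma)$, then $\mathit{Safe}_n(c,s,h,\rho,\Gamma,Q,A)$ holds for all $n\ge0$.
   Context: States and assertions: stores $s:\mathbf{Var}\to\mathbf{Val}$, finite partial heaps $h$, $\mathcal{S}$ the set of pairs $(s,h)$; separation-logic assertions with standard satisfaction $s,h\models P$ and free variables $FV$; $h\bot g$ disjoint domains, $h\uplus g$ union. Basic commands $c::=x:=e\mid x:=[e]\mid[e]:=e'\mid x:=\mathsf{cons}(e_1,\dots,e_n)\mid\mathsf{dispose}(e)$ with standard separation-logic semantics $[c](s,h)$ (a result pair or $\mathsf{abort}$ on access outside $dom(h)$; $\mathsf{cons}$ allocates fresh consecutive cells). $mod(c)$ is $\{x\}$ for $x:=e$, $x:=[e]$, $x:=\mathsf{cons}(\dots)$ and $\emptyset$ otherwise. $\vdash^{SL}\{P\}c\{Q\}$ denotes derivability in standard sequential separation logic. A resource context $\Gamma=r_1(X_1):R_1,\dots,r_n(X_n):R_n$ (distinct resource names, $X_i\subseteq\mathbf{Var}$, precise $R_i$ with $FV(R_i)\subseteq X_i$); $PV(r_i)=X_i$, $PV(\Gamma)=\bigcup X_i$, $\Gamma(r_i)=R_i$; $\circledast_{r\in D}\Gamma(r)$ separating conjunction over $D$ ($\texttt{emp}$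 if empty). A resource configuration is a triple $(O,L,D)$ of pairwise disjoint sets of resource names. Transitions: program transitions $\to_p$ of the structural operational semantics; for a basic command, $c,(s,h,\rho)\to_p\mathsf{skip},(s',h',\rho)$ whenever $(s',h')$ is a result of $[c](s,h)$, and $c,(s,h,\rho)\to_p\mathsf{abort}$ iff $[c](s,h)=\mathsf{abort}$; $\mathsf{skip}$ has no program transitions. $Locked(c)=Locked(\mathsf{skip})=\emptyset$ (in general $Locked(C)$ is the set of resources held inside $C$ by $\mathsf{within}$ constructs not bound by a $\mathsf{resource}$ declaration). Environment: $(s,h,(O,L,D))\stackrel{A}{\leftrightsquigarrow}(s',h,(O,L',D'))$ iff $s(x)=s'(x)$ for $x\in A$ and $L'\cup D'=L\cup D$; with $A'=A\cup\bigcup_{r\in Locked(C)}PV(r)$, if $(s,h,\rho)\stackrel{A'}{\leftrightsquigarrow}(s',h,\rho')$, $\rho=(O,L,D)$, $\rho'=(O,L',D')$, $s,h_G\models\circledast_{r\in D}\Gamma(r)$, $s',h'_G\models\circledast_{r\in D'}\Gamma(r)$, then $C,(s,h\uplus h_G,\rho)\xrightarrow{A,\Gamma}_eC,(s',h\uplus h'_G,\rho')$; $\xrightarrow{A,\Gamma}=\to_p\cup\xrightarrow{A,\Gamma}_e$. $chng(C)$: variables $x$ such that the next transition of $C$ can execute $x:=e$, $x:=[e]$ or $x:=\mathsf{cons}(\dots)$. Safety: $\mathit{Safe}_0$ always holds; $\mathit{Safe}_{n+1}(C,s,h,\rho,\Gamma,Q,A)$, $\rho=(O,L,D)$, iff (i)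 $C=\mathsf{skip}\Rightarrow s,h\models Q$; (ii) $C,(s,h,\rho)\not\to_p\mathsf{abort}$; (iii) $chng(C)\cap\bigcup_{r\in L\cup D}PV(r)=\emptyset$; (iv) for every $h_G\bot h$ with $s,h_G\models\circledast_{r\in D}\Gamma(r)$ and every $C,(s,h\uplus h_G,\rho)\xrightarrow{A,\Gamma}C',(s',\hat h,\rho')$, $\rho'=(O',L',D')$, there exist $h',h'_G$ with $\hat h=h'\uplus h'_G$, $s',h'_G\models\circledast_{r\in D'}\Gamma(r)$ and $\mathit{Safe}_n(C',s',h',\rho',\Gamma,Q,A)$. -}

module Defs where

open import Level using (0ℓ)
open import Data.Nat as ℕ using (ℕ; zero; suc)
open import Data.Integer as ℤ using (ℤ)
open import Data.Bool using (Bool; true; false; if_then_else_)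
open import Data.Maybe using (Maybe; just; nothing)
open import Data.List as List using (List; []; _∷_; _++_)
open import Data.List.Membership.Propositional using () renaming (_∈_ to _∈ₗ_)
open import Data.Vec using (Vec; []; _∷_; lookup)
open import Data.Fin using (Fin)
open import Data.Fin.Subset using (Subset; _∪_; _∩_; inside; outside) renaming (⊥ to ∅ₛ; _∈_ to _∈ₛ_)
open import Data.Product using (Σ; Σ-syntax; ∃; ∃-syntax; _×_; _,_)
open import Data.Sum using (_⊎_)
open import Data.Unit using (⊤)
open import Data.Empty using () renaming (⊥ to ⊥₀)
open import Relation.Nullary using (¬_; yes; no)
open import Relation.Binary.PropositionalEquality using (_≡_; _≢_)

Var : Set
Var = ℕ

Val : Set
Val = ℤ

VarSet : Set₁
VarSet = Var → Set

Store : Set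
Store = Var → Val

Heap : Set
Heap = Val → Maybe Val

Finite : Heap → Set
Finite h = Σ (List Val) λ ls → ∀ l v → h l ≡ just v → l ∈ₗ ls

_≈ₕ_ : Heap → Heap → Set
h ≈ₕ g = ∀ l → h l ≡ g l

_⊥ₕ_ : Heap → Heap → Set
h ⊥ₕ g = ∀ l → (h l ≡ nothing) ⊎ (g l ≡ nothing)

-- union h ⊎ g (meaningful for disjoint heaps)
_⊎ₕ_ : Heap → Heap → Heap
(h ⊎ₕ g) l with h l
... | just v  = just v
... | nothing = g l

emptyHeap : Heap
emptyHeap _ = nothing

_[_↦ₛ_] : Store → Var → Val → Store
(s [ x ↦ₛ v ]) y with y ℕ.≟ x
... | yes _ = v
... | no  _ = s y

_[_↦ₕ_] : Heap → Val → Val → Heap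
(h [ l ↦ₕ v ]) l' with l' ℤ.≟ l
... | yes _ = just v
... | no  _ = h l'

_∖ₕ_ : Heap → Val → Heap
(h ∖ₕ l) l' with l' ℤ.≟ l
... | yes _ = nothing
... | no  _ = h l'

data Exp : Set where
  var  : Var → Exp
  lit  : ℤ → Exp
  _⊕_  : Exp → Exp → Exp
  _⊖_  : Exp → Exp → Exp
  _⊗_  : Exp → Exp → Exp

⟦_⟧ₑ : Exp → Store → Val
⟦ var x ⟧ₑ s = s x
⟦ lit n ⟧ₑ s = n
⟦ e ⊕ e' ⟧ₑ s = ⟦ e ⟧ₑ s ℤ.+ ⟦ e' ⟧ₑ s
⟦ e ⊖ e' ⟧ₑ s = ⟦ e ⟧ₑ s ℤ.- ⟦ e' ⟧ₑ s
⟦ e ⊗ e' ⟧ₑ s = ⟦ e ⟧ₑ s ℤ.* ⟦ e' ⟧ₑ s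

fvE : Exp → List Var
fvE (var x) = x ∷ []
fvE (lit _) = []
fvE (e ⊕ e') = fvE e ++ fvE e'
fvE (e ⊖ e') = fvE e ++ fvE e'
fvE (e ⊗ e') = fvE e ++ fvE e'

substE : (Var → Exp) → Exp → Exp
substE σ (var x) = σ x
substE σ (lit n) = lit n
substE σ (e ⊕ e') = substE σ e ⊕ substE σ e'
substE σ (e ⊖ e') = substE σ e ⊖ substE σ e'
substE σ (e ⊗ e') = substE σ e ⊗ substE σ e'

data Assert : Set where
  ttA ffA : Assert
  _≐_  : Exp → Exp → Assert
  _≤ₐ_ : Exp → Exp → Assert
  emp  : Assert
  _↦_  : Exp → Exp → Assert
  _∧ₐ_ _∨ₐ_ _⇒ₐ_ : Assert → Assert → Assert
  ∀ₐ ∃ₐ : Var → Assert → Assert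
  _∗_ _−∗_ : Assert → Assert → Assert

infixr 6 _∗_
infixr 5 _−∗_

_,_⊨_ : Store → Heap → Assert → Set
s , h ⊨ ttA = ⊤
s , h ⊨ ffA = ⊥₀
s , h ⊨ (e ≐ e') = ⟦ e ⟧ₑ s ≡ ⟦ e' ⟧ₑ s
s , h ⊨ (e ≤ₐ e') = ⟦ e ⟧ₑ s ℤ.≤ ⟦ e' ⟧ₑ s
s , h ⊨ emp = ∀ l → h l ≡ nothing
s , h ⊨ (e ↦ e') = (h (⟦ e ⟧ₑ s) ≡ just (⟦ e' ⟧ₑ s)) × (∀ l → l ≢ ⟦ e ⟧ₑ s → h l ≡ nothing)
s , h ⊨ (P ∧ₐ Q) = (s , h ⊨ P) × (s , h ⊨ Q)
s , h ⊨ (P ∨ₐ Q) = (s , h ⊨ P) ⊎ (s , h ⊨ Q)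
s , h ⊨ (P ⇒ₐ Q) = (s , h ⊨ P) → (s , h ⊨ Q)
s , h ⊨ ∀ₐ x P = ∀ v → (s [ x ↦ₛ v ]) , h ⊨ P
s , h ⊨ ∃ₐ x P = Σ Val λ v → (s [ x ↦ₛ v ]) , h ⊨ P
s , h ⊨ (P ∗ Q) = Σ Heap λ h₁ → Σ Heap λ h₂ →
  (h₁ ⊥ₕ h₂) × (h ≈ₕ (h₁ ⊎ₕ h₂)) × (s , h₁ ⊨ P) × (s , h₂ ⊨ Q)
s , h ⊨ (P −∗ Q) = ∀ h' → Finite h' → h ⊥ₕ h' → s , h' ⊨ P → s , (h ⊎ₕ h') ⊨ Q

_∈FVₑ_ : Var → Exp → Set
x ∈FVₑ e = x ∈ₗ fvE e

_∈FV_ : Var → Assert → Set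
x ∈FV ttA = ⊥₀
x ∈FV ffA = ⊥₀
x ∈FV (e ≐ e') = (x ∈FVₑ e) ⊎ (x ∈FVₑ e')
x ∈FV (e ≤ₐ e') = (x ∈FVₑ e) ⊎ (x ∈FVₑ e')
x ∈FV emp = ⊥₀
x ∈FV (e ↦ e') = (x ∈FVₑ e) ⊎ (x ∈FVₑ e')
x ∈FV (P ∧ₐ Q) = (x ∈FV P) ⊎ (x ∈FV Q)
x ∈FV (P ∨ₐ Q) = (x ∈FV P) ⊎ (x ∈FV Q)
x ∈FV (P ⇒ₐ Q) = (x ∈FV P) ⊎ (x ∈FV Q)
x ∈FV ∀ₐ y P = (x ≢ y) × (x ∈FV P)
x ∈FV ∃ₐ y P = (x ≢ y) × (x ∈FV P)
x ∈FV (P ∗ Q) = (x ∈FV P) ⊎ (x ∈FV Q)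
x ∈FV (P −∗ Q) = (x ∈FV P) ⊎ (x ∈FV Q)

-- all variables occurring in an assertion (free or bound); used only to
-- pick fresh names
varsA : Assert → List Var
varsA ttA = []
varsA ffA = []
varsA (e ≐ e') = fvE e ++ fvE e'
varsA (e ≤ₐ e') = fvE e ++ fvE e'
varsA emp = []
varsA (e ↦ e') = fvE e ++ fvE e'
varsA (P ∧ₐ Q) = varsA P ++ varsA Q
varsA (P ∨ₐ Q) = varsA P ++ varsA Q
varsA (P ⇒ₐ Q) = varsA P ++ varsA Q
varsA (∀ₐ y P) = y ∷ varsA P
varsA (∃ₐ y P) = y ∷ varsA P
varsA (P ∗ Q) = varsA P ++ varsA Q
varsA (P −∗ Q) = varsA P ++ varsA Q

maxL : List ℕ → ℕ
maxL = List.foldr ℕ._⊔_ 0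

freshFor : List Var → Var
freshFor xs = suc (maxL xs)

updσ : (Var → Exp) → Var → Exp → (Var → Exp)
updσ σ x e y with y ℕ.≟ x
... | yes _ = e
... | no  _ = σ y

-- capture-avoiding simultaneous substitution (bound variables are renamed
-- to a fresh variable at every binder)
substA : (Var → Exp) → Assert → Assert
substA σ ttA = ttA
substA σ ffA = ffA
substA σ (e ≐ e') = substE σ e ≐ substE σ e'
substA σ (e ≤ₐ e') = substE σ e ≤ₐ substE σ e'
substA σ emp = emp
substA σ (e ↦ e') = substE σ e ↦ substE σ e'
substA σ (P ∧ₐ Q) = substA σ P ∧ₐ substA σ Q
substA σ (P ∨ₐ Q) = substA σ P ∨ₐ substA σ Q
substA σ (P ⇒ₐ Q) = substA σ P ⇒ₐ substA σ Q
substA σ (∀ₐ x P) =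
  let y = freshFor (x ∷ varsA P ++ List.concatMap (λ z → fvE (σ z)) (varsA P))
  in ∀ₐ y (substA (updσ σ x (var y)) P)
substA σ (∃ₐ x P) =
  let y = freshFor (x ∷ varsA P ++ List.concatMap (λ z → fvE (σ z)) (varsA P))
  in ∃ₐ y (substA (updσ σ x (var y)) P)
substA σ (P ∗ Q) = substA σ P ∗ substA σ Q
substA σ (P −∗ Q) = substA σ P −∗ substA σ Q

_[_/_] : Assert → Exp → Var → Assert
P [ e / x ] = substA (updσ var x e) P

_↦− : Exp → Assert
e ↦− = let v = freshFor (fvE e) in ∃ₐ v (e ↦ var v)

_↦⋯_ : Exp → List Exp → Assert
e ↦⋯ [] = emp
e ↦⋯ (e₁ ∷ es) = (e ↦ e₁) ∗ ((e ⊕ lit (ℤ.+ 1)) ↦⋯ es)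

-- semantic entailment (over states of 𝒮, i.e. finite heaps)
_⊨ₑ_ : Assert → Assert → Set
P ⊨ₑ Q = ∀ s h → Finite h → s , h ⊨ P → s , h ⊨ Q

_⊑ₕ_ : Heap → Heap → Set
h' ⊑ₕ h = ∀ l v → h' l ≡ just v → h l ≡ just v

Precise : Assert → Set
Precise R = ∀ s h h₁ h₂ → Finite h → h₁ ⊑ₕ h → h₂ ⊑ₕ h →
  s , h₁ ⊨ R → s , h₂ ⊨ R → h₁ ≈ₕ h₂

data BCmd : Set where
  _≔_      : Var → Exp → BCmd
  _≔[_]    : Var → Exp → BCmd
  [_]≔_    : Exp → Exp → BCmd
  _≔cons_  : Var → List Exp → BCmd
  dispose  : Exp → BCmd

_∈mod_ : Var → BCmd → Set
y ∈mod (x ≔ e) = y ≡ x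
y ∈mod (x ≔[ e ]) = y ≡ x
y ∈mod ([ e ]≔ e') = ⊥₀
y ∈mod (x ≔cons es) = y ≡ x
y ∈mod dispose e = ⊥₀

_∈FVc_ : Var → BCmd → Set
y ∈FVc (x ≔ e) = (y ≡ x) ⊎ (y ∈FVₑ e)
y ∈FVc (x ≔[ e ]) = (y ≡ x) ⊎ (y ∈FVₑ e)
y ∈FVc ([ e ]≔ e') = (y ∈FVₑ e) ⊎ (y ∈FVₑ e')
y ∈FVc (x ≔cons es) = (y ≡ x) ⊎ (y ∈ₗ List.concatMap fvE es)
y ∈FVc dispose e = y ∈FVₑ e

data Result : Set where
  ok    : Store → Heap → Result
  abort : Result

FreshBlock : Heap → Val → ℕ → Set
FreshBlock h l zero = ⊤
FreshBlock h l (suc n) = (h l ≡ nothing) × FreshBlock h (l ℤ.+ ℤ.+ 1) n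

allocAt : Heap → Val → List Val → Heap
allocAt h l [] = h
allocAt h l (v ∷ vs) = allocAt (h [ l ↦ₕ v ]) (l ℤ.+ ℤ.+ 1) vs

-- [c](s,h) ∋ r   (relational: cons is nondeterministic)
data ⟦_⟧_,_⇓_ : BCmd → Store → Heap → Result → Set where
  assign    : ∀ {x e s h} → ⟦ x ≔ e ⟧ s , h ⇓ ok (s [ x ↦ₛ ⟦ e ⟧ₑ s ]) h
  lookup-ok : ∀ {x e s h v} → h (⟦ e ⟧ₑ s) ≡ just v → ⟦ x ≔[ e ] ⟧ s , h ⇓ ok (s [ x ↦ₛ v ]) h
  lookup-ab : ∀ {x e s h} → h (⟦ e ⟧ₑ s) ≡ nothing → ⟦ x ≔[ e ] ⟧ s , h ⇓ abort
  mutate-ok : ∀ {e e' s h v} → h (⟦ e ⟧ₑ s) ≡ just v →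
              ⟦ [ e ]≔ e' ⟧ s , h ⇓ ok s (h [ ⟦ e ⟧ₑ s ↦ₕ ⟦ e' ⟧ₑ s ])
  mutate-ab : ∀ {e e' s h} → h (⟦ e ⟧ₑ s) ≡ nothing → ⟦ [ e ]≔ e' ⟧ s , h ⇓ abort
  cons-ok   : ∀ {x es s h l} → FreshBlock h l (List.length es) →
              ⟦ x ≔cons es ⟧ s , h ⇓ ok (s [ x ↦ₛ l ]) (allocAt h l (List.map (λ e → ⟦ e ⟧ₑ s) es))
  dispose-ok : ∀ {e s h v} → h (⟦ e ⟧ₑ s) ≡ just v →
               ⟦ dispose e ⟧ s , h ⇓ ok s (h ∖ₕ ⟦ e ⟧ₑ s)
  dispose-ab : ∀ {e s h} → h (⟦ e ⟧ₑ s) ≡ nothing → ⟦ dispose e ⟧ s , h ⇓ abort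

data ⊢SL⟨_⟩_⟨_⟩ : Assert → BCmd → Assert → Set where
  sl-assign : ∀ {x e Q} → ⊢SL⟨ Q [ e / x ] ⟩ (x ≔ e) ⟨ Q ⟩
  sl-lookup : ∀ {x e Q v} → ¬ (v ∈FVₑ e) → (v ∈FV Q → v ≡ x) →
    ⊢SL⟨ ∃ₐ v ((e ↦ var v) ∗ ((e ↦ var v) −∗ (Q [ var v / x ]))) ⟩ (x ≔[ e ]) ⟨ Q ⟩
  sl-mutate : ∀ {e e' Q} → ⊢SL⟨ (e ↦−) ∗ ((e ↦ e') −∗ Q) ⟩ ([ e ]≔ e') ⟨ Q ⟩
  sl-cons   : ∀ {x es Q v} → ¬ (v ∈ₗ List.concatMap fvE es) → ¬ (v ∈FV Q) →
    ⊢SL⟨ ∀ₐ v ((var v ↦⋯ es) −∗ (Q [ var v / x ])) ⟩ (x ≔cons es) ⟨ Q ⟩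
  sl-dispose : ∀ {e Q} → ⊢SL⟨ (e ↦−) ∗ Q ⟩ (dispose e) ⟨ Q ⟩
  sl-conseq : ∀ {P P' c Q Q'} → P ⊨ₑ P' → ⊢SL⟨ P' ⟩ c ⟨ Q' ⟩ → Q' ⊨ₑ Q → ⊢SL⟨ P ⟩ c ⟨ Q ⟩
  sl-frame  : ∀ {P c Q R} → ⊢SL⟨ P ⟩ c ⟨ Q ⟩ → (∀ x → x ∈mod c → ¬ (x ∈FV R)) →
    ⊢SL⟨ P ∗ R ⟩ c ⟨ Q ∗ R ⟩
  sl-exists : ∀ {P c Q x} → ⊢SL⟨ P ⟩ c ⟨ Q ⟩ → ¬ (x ∈FVc c) → ⊢SL⟨ ∃ₐ x P ⟩ c ⟨ ∃ₐ x Q ⟩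
  sl-disj   : ∀ {P₁ P₂ c Q₁ Q₂} → ⊢SL⟨ P₁ ⟩ c ⟨ Q₁ ⟩ → ⊢SL⟨ P₂ ⟩ c ⟨ Q₂ ⟩ →
    ⊢SL⟨ P₁ ∨ₐ P₂ ⟩ c ⟨ Q₁ ∨ₐ Q₂ ⟩
  sl-conj   : ∀ {P₁ P₂ c Q₁ Q₂} → ⊢SL⟨ P₁ ⟩ c ⟨ Q₁ ⟩ → ⊢SL⟨ P₂ ⟩ c ⟨ Q₂ ⟩ →
    ⊢SL⟨ P₁ ∧ₐ P₂ ⟩ c ⟨ Q₁ ∧ₐ Q₂ ⟩

-- Resource contexts and configurations.
-- Resource names of Γ = r₁(X₁):R₁,…,rₙ(Xₙ):Rₙ are the positions Fin n
-- (hence automatically distinct).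

record ResDecl : Set₁ where
  field
    X       : VarSet
    R       : Assert
    precise : Precise R
    fv⊆X    : ∀ x → x ∈FV R → X x

ResCtx : ℕ → Set₁
ResCtx n = Vec ResDecl n

PV : ∀ {n} → ResCtx n → Fin n → VarSet
PV Γ r = ResDecl.X (lookup Γ r)

PVΓ : ∀ {n} → ResCtx n → VarSet
PVΓ Γ x = Σ _ λ r → PV Γ r x

PVof : ∀ {n} → ResCtx n → Subset n → VarSet
PVof Γ S x = Σ _ λ r → (r ∈ₛ S) × PV Γ r x

⊛ : ∀ {n} → ResCtx n → Subset n → Assert
⊛ [] [] = emp
⊛ (d ∷ Γ) (inside ∷ D) = ResDecl.R d ∗ ⊛ Γ D
⊛ (d ∷ Γ) (outside ∷ D) = ⊛ Γ D

record RConf (n : ℕ) : Set where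
  constructor ⟨_,_,_⟩[_,_,_]
  field
    O L D : Subset n
    O∩L : O ∩ L ≡ ∅ₛ
    O∩D : O ∩ D ≡ ∅ₛ
    L∩D : L ∩ D ≡ ∅ₛ

-- Commands of the concurrent language reachable from a basic command:
-- the basic command itself and skip.

data Cmd : Set where
  skip  : Cmd
  basic : BCmd → Cmd

Locked : ∀ {n} → Cmd → Subset n
Locked skip = ∅ₛ
Locked (basic c) = ∅ₛ

_∈chng_ : Var → Cmd → Set
x ∈chng skip = ⊥₀
x ∈chng basic c = x ∈mod c

data _,⟨_,_,_⟩→p_,⟨_,_,_⟩ {n} : Cmd → Store → Heap → RConf n → Cmd → Store → Heap → RConf n → Set where
  p-basic : ∀ {c s h ρ s' h'} → ⟦ c ⟧ s , h ⇓ ok s' h' →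
    basic c ,⟨ s , h , ρ ⟩→p skip ,⟨ s' , h' , ρ ⟩

data _,⟨_,_,_⟩→p-abort {n} : Cmd → Store → Heap → RConf n → Set where
  p-abort : ∀ {c s h ρ} → ⟦ c ⟧ s , h ⇓ abort → basic c ,⟨ s , h , ρ ⟩→p-abort

-- (s,h,ρ) ~A~ (s',h,ρ')  (the heap component is shared)
EnvRel : ∀ {n} → VarSet → Store → RConf n → Store → RConf n → Set
EnvRel A s ρ s' ρ' =
  (∀ x → A x → s x ≡ s' x) × (RConf.O ρ' ≡ RConf.O ρ) ×
  (RConf.L ρ' ∪ RConf.D ρ' ≡ RConf.L ρ ∪ RConf.D ρ)

data EnvStep {n} (A : VarSet) (Γ : ResCtx n) :
       Cmd → Store → Heap → RConf n → Cmd → Store → Heap → RConf n → Set where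
  env : ∀ {C s s' ρ ρ' h hG hG' ĥ ĥ'} →
    EnvRel (λ x → A x ⊎ PVof Γ (Locked C) x) s ρ s' ρ' →
    h ⊥ₕ hG → h ⊥ₕ hG' → Finite hG → Finite hG' →
    s , hG ⊨ ⊛ Γ (RConf.D ρ) → s' , hG' ⊨ ⊛ Γ (RConf.D ρ') →
    ĥ ≈ₕ (h ⊎ₕ hG) → ĥ' ≈ₕ (h ⊎ₕ hG') →
    EnvStep A Γ C s ĥ ρ C s' ĥ' ρ'

Step : ∀ {n} → VarSet → ResCtx n →
       Cmd → Store → Heap → RConf n → Cmd → Store → Heap → RConf n → Set
Step A Γ C s h ρ C' s' h' ρ' =
  (C ,⟨ s , h , ρ ⟩→p C' ,⟨ s' , h' , ρ' ⟩) ⊎ EnvStep A Γ C s h ρ C' s' h' ρ'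

Safe : ∀ {n} → ℕ → Cmd → Store → Heap → RConf n → ResCtx n → Assert → VarSet → Set
Safe zero C s h ρ Γ Q A = ⊤
Safe (suc k) C s h ρ Γ Q A =
  (C ≡ skip → s , h ⊨ Q) ×
  (¬ (C ,⟨ s , h , ρ ⟩→p-abort)) ×
  (∀ x → x ∈chng C → ¬ PVof Γ (RConf.L ρ ∪ RConf.D ρ) x) ×
  (∀ hG → Finite hG → h ⊥ₕ hG → s , hG ⊨ ⊛ Γ (RConf.D ρ) →
   ∀ C' s' ĥ ρ' → Step A Γ C s (h ⊎ₕ hG) ρ C' s' ĥ ρ' →
   Σ Heap λ h' → Σ Heap λ hG' →
     (h' ⊥ₕ hG') × (ĥ ≈ₕ (h' ⊎ₕ hG')) ×
     (s' , hG' ⊨ ⊛ Γ (RConf.D ρ')) × Safe k C' s' h' ρ' Γ Q A)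

module Submission where

-- Executing a basic command is a single atomic step, so everything rests on the soundness of
-- sequential separation logic in its local form: started on a P-heap extended by any disjoint
-- frame, c does not abort and every outcome is a Q-heap next to the unchanged frame.  For a program step the shared heap holding the resource invariants
-- serves as the frame; the invariants survive because c modifies no variable of PV(Γ), and what
-- remains is skip on a Q-heap.  An environment step changes only variables outside A, hence none
-- of P or Q, and leaves the local heap alone: the invariants are precise, so the shared part of
-- the total heap is uniquely determined.

open import Defs
open import Level using (0ℓ)
open import Data.Nat as ℕ using (ℕ; zero; suc)
open import Data.Nat.Properties as ℕP using ()
open import Data.Integer as ℤ using (ℤ)
open import Data.Integer.Properties as ℤP using ()
open import Data.Maybe using (Maybe; just; nothing)
open import Data.Maybe.Properties using (just-injective)
open import Data.List as List using (List; []; _∷_; _++_)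
open import Data.List.Properties using (length-map)
open import Data.List.Membership.Propositional using (lose) renaming (_∈_ to _∈ₗ_)
open import Data.List.Membership.Propositional.Properties using (∈-++⁺ˡ; ∈-++⁺ʳ; ∈-concatMap⁺)
open import Data.List.Relation.Unary.Any using (here; there)
open import Data.Vec using ([]; _∷_)
open import Data.Fin using (zero; suc)
open import Data.Fin.Subset using (inside; outside)
open import Data.Product using (Σ; _×_; _,_; proj₁; proj₂)
open import Data.Sum using (_⊎_; inj₁; inj₂)
open import Data.Empty using (⊥-elim)
open import Relation.Nullary using (¬_; yes; no; Dec)
open import Relation.Binary.Bundles using (Setoid)
open import Relation.Binary.PropositionalEquality
open import Function using (_∘_)
import Relation.Binary.Reasoning.Setoid as SetoidReasoning

-- Heap algebra

heapSetoid : Setoid 0ℓ 0ℓ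
heapSetoid = Val →-setoid Maybe Val

open Setoid heapSetoid using () renaming (refl to ≈ₕ-refl; sym to ≈ₕ-sym; trans to ≈ₕ-trans)
module ≈ₕ-Reasoning = SetoidReasoning heapSetoid

just≢nothing : ∀ {A : Set} {v : A} → just v ≢ nothing
just≢nothing ()

⊎ₕ-just : ∀ a b {l v} → a l ≡ just v → (a ⊎ₕ b) l ≡ just v
⊎ₕ-just a b {l} al with a l
⊎ₕ-just a b refl | just _ = refl

⊎ₕ-nothingˡ : ∀ a b {l} → a l ≡ nothing → (a ⊎ₕ b) l ≡ b l
⊎ₕ-nothingˡ a b {l} al with a l
⊎ₕ-nothingˡ a b refl | nothing = refl

⊎ₕ-nothingʳ : ∀ a b {l} → b l ≡ nothing → (a ⊎ₕ b) l ≡ a l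
⊎ₕ-nothingʳ a b {l} bl with a l
... | just _ = refl
... | nothing = bl

⊎ₕ-cong : ∀ {a a' b b'} → a ≈ₕ a' → b ≈ₕ b' → (a ⊎ₕ b) ≈ₕ (a' ⊎ₕ b')
⊎ₕ-cong {a} {a'} a≈a' b≈b' l with a l | a' l | a≈a' l
... | just v  | just .v | refl = refl
... | nothing | nothing | refl = b≈b' l

⊎ₕ-congˡ : ∀ a {b b'} → b ≈ₕ b' → (a ⊎ₕ b) ≈ₕ (a ⊎ₕ b')
⊎ₕ-congˡ a = ⊎ₕ-cong (≈ₕ-refl {a})

⊎ₕ-congʳ : ∀ {a a'} b → a ≈ₕ a' → (a ⊎ₕ b) ≈ₕ (a' ⊎ₕ b)
⊎ₕ-congʳ b a≈a' = ⊎ₕ-cong a≈a' (≈ₕ-refl {b})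

⊎ₕ-assoc : ∀ a b c → ((a ⊎ₕ b) ⊎ₕ c) ≈ₕ (a ⊎ₕ (b ⊎ₕ c))
⊎ₕ-assoc a b c l with a l
... | just _ = refl
... | nothing = refl

⊎ₕ-identityʳ : ∀ a → (a ⊎ₕ emptyHeap) ≈ₕ a
⊎ₕ-identityʳ a l = ⊎ₕ-nothingʳ a emptyHeap refl

⊎ₕ-comm : ∀ a b → a ⊥ₕ b → (a ⊎ₕ b) ≈ₕ (b ⊎ₕ a)
⊎ₕ-comm a b a⊥b l with a⊥b l
... | inj₁ al = trans (⊎ₕ-nothingˡ a b al) (sym (⊎ₕ-nothingʳ b a al))
... | inj₂ bl = trans (⊎ₕ-nothingʳ a b bl) (sym (⊎ₕ-nothingˡ b a bl))

⊎ₕ-cancelʳ : ∀ {a b c} → a ⊥ₕ c → b ⊥ₕ c → (a ⊎ₕ c) ≈ₕ (b ⊎ₕ c) → a ≈ₕ b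
⊎ₕ-cancelʳ {a} {b} {c} a⊥c b⊥c eq l with a⊥c l | b⊥c l
... | inj₁ al | inj₁ bl = trans al (sym bl)
... | inj₂ cl | _       = trans (sym (⊎ₕ-nothingʳ a c cl)) (trans (eq l) (⊎ₕ-nothingʳ b c cl))
... | inj₁ _  | inj₂ cl = trans (sym (⊎ₕ-nothingʳ a c cl)) (trans (eq l) (⊎ₕ-nothingʳ b c cl))

⊥ₕ-sym : ∀ {a b} → a ⊥ₕ b → b ⊥ₕ a
⊥ₕ-sym a⊥b l with a⊥b l
... | inj₁ al = inj₂ al
... | inj₂ bl = inj₁ bl

⊥ₕ-emptyʳ : ∀ a → a ⊥ₕ emptyHeap
⊥ₕ-emptyʳ a l = inj₂ refl

⊥ₕ-respˡ : ∀ {a a' b} → a ≈ₕ a' → a ⊥ₕ b → a' ⊥ₕ b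
⊥ₕ-respˡ a≈a' a⊥b l with a⊥b l
... | inj₁ al = inj₁ (trans (sym (a≈a' l)) al)
... | inj₂ bl = inj₂ bl

⊥ₕ-respʳ : ∀ {a b b'} → b ≈ₕ b' → a ⊥ₕ b → a ⊥ₕ b'
⊥ₕ-respʳ b≈b' a⊥b = ⊥ₕ-sym (⊥ₕ-respˡ b≈b' (⊥ₕ-sym a⊥b))

⊥ₕ-⊎ʳ : ∀ {a b c} → a ⊥ₕ b → a ⊥ₕ c → a ⊥ₕ (b ⊎ₕ c)
⊥ₕ-⊎ʳ {b = b} {c} a⊥b a⊥c l with a⊥b l | a⊥c l
... | inj₁ al | _       = inj₁ al
... | inj₂ _  | inj₁ al = inj₁ al
... | inj₂ bl | inj₂ cl = inj₂ (trans (⊎ₕ-nothingˡ b c bl) cl)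

⊥ₕ-⊎ˡ : ∀ {a b c} → a ⊥ₕ c → b ⊥ₕ c → (a ⊎ₕ b) ⊥ₕ c
⊥ₕ-⊎ˡ a⊥c b⊥c = ⊥ₕ-sym (⊥ₕ-⊎ʳ (⊥ₕ-sym a⊥c) (⊥ₕ-sym b⊥c))

⊥ₕ-⊎ʳ⁻ˡ : ∀ {a b c} → a ⊥ₕ (b ⊎ₕ c) → a ⊥ₕ b
⊥ₕ-⊎ʳ⁻ˡ {b = b} {c} a⊥bc l with b l | a⊥bc l
... | _       | inj₁ al = inj₁ al
... | just _  | inj₂ ()
... | nothing | inj₂ _  = inj₂ refl

⊥ₕ-⊎ʳ⁻ʳ : ∀ {a b c} → a ⊥ₕ (b ⊎ₕ c) → a ⊥ₕ c
⊥ₕ-⊎ʳ⁻ʳ {b = b} {c} a⊥bc l with b l | a⊥bc l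
... | _       | inj₁ al = inj₁ al
... | just _  | inj₂ ()
... | nothing | inj₂ cl = inj₂ cl

⊑ₕ-trans : ∀ {a b c} → a ⊑ₕ b → b ⊑ₕ c → a ⊑ₕ c
⊑ₕ-trans a⊑b b⊑c l v al = b⊑c l v (a⊑b l v al)

≈ₕ⇒⊑ₕ : ∀ {a b} → a ≈ₕ b → a ⊑ₕ b
≈ₕ⇒⊑ₕ a≈b l v al = trans (sym (a≈b l)) al

⊑ₕ-⊎ˡ : ∀ a b → a ⊑ₕ (a ⊎ₕ b)
⊑ₕ-⊎ˡ a b l v al = ⊎ₕ-just a b al

⊑ₕ-⊎ʳ : ∀ a b → a ⊥ₕ b → b ⊑ₕ (a ⊎ₕ b)
⊑ₕ-⊎ʳ a b a⊥b l v bl with a⊥b l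
... | inj₁ al = trans (⊎ₕ-nothingˡ a b al) bl
... | inj₂ bl' = ⊥-elim (just≢nothing (trans (sym bl) bl'))

split-⊑ˡ : ∀ {h a b} → h ≈ₕ (a ⊎ₕ b) → a ⊑ₕ h
split-⊑ˡ {a = a} {b} h≈ab = ⊑ₕ-trans (⊑ₕ-⊎ˡ a b) (≈ₕ⇒⊑ₕ (≈ₕ-sym h≈ab))

split-⊑ʳ : ∀ {h a b} → a ⊥ₕ b → h ≈ₕ (a ⊎ₕ b) → b ⊑ₕ h
split-⊑ʳ {a = a} {b} a⊥b h≈ab = ⊑ₕ-trans (⊑ₕ-⊎ʳ a b a⊥b) (≈ₕ⇒⊑ₕ (≈ₕ-sym h≈ab))

⊑ₕ-⊥ₕ : ∀ {a b c} → a ⊑ₕ b → b ⊥ₕ c → a ⊥ₕ c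
⊑ₕ-⊥ₕ {a} a⊑b b⊥c l with a l in al
... | nothing = inj₁ refl
... | just v with b⊥c l
...   | inj₁ bl = ⊥-elim (just≢nothing (trans (sym (a⊑b l v al)) bl))
...   | inj₂ cl = inj₂ cl

⊎ₕ-regroup : ∀ {H h} h₁ h₂ hF → H ≈ₕ (h ⊎ₕ hF) → h ≈ₕ (h₁ ⊎ₕ h₂) → H ≈ₕ (h₁ ⊎ₕ (h₂ ⊎ₕ hF))
⊎ₕ-regroup {H} {h} h₁ h₂ hF H≈ h≈ = begin
  H                     ≈⟨ H≈ ⟩
  h ⊎ₕ hF               ≈⟨ ⊎ₕ-congʳ hF h≈ ⟩
  (h₁ ⊎ₕ h₂) ⊎ₕ hF      ≈⟨ ⊎ₕ-assoc h₁ h₂ hF ⟩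
  h₁ ⊎ₕ (h₂ ⊎ₕ hF)      ∎
  where open ≈ₕ-Reasoning

Finite-⊑ₕ : ∀ {a b} → a ⊑ₕ b → Finite b → Finite a
Finite-⊑ₕ a⊑b (ls , fin) = ls , λ l v al → fin l v (a⊑b l v al)

Finite-⊎ₕ : ∀ {a b} → Finite a → Finite b → Finite (a ⊎ₕ b)
Finite-⊎ₕ {a} {b} (la , fa) (lb , fb) = la ++ lb , dom
  where
  dom : ∀ l v → (a ⊎ₕ b) l ≡ just v → l ∈ₗ (la ++ lb)
  dom l v abl with a l in al
  ... | just w  = ∈-++⁺ˡ (fa l w al)
  ... | nothing = ∈-++⁺ʳ la (fb l v abl)

Finite-empty : Finite emptyHeap
Finite-empty = [] , λ _ _ ()

-- Updates and cells

updₛ-same : ∀ s x v → (s [ x ↦ₛ v ]) x ≡ v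
updₛ-same s x v with x ℕ.≟ x
... | yes _ = refl
... | no x≢x = ⊥-elim (x≢x refl)

updₛ-other : ∀ s x v y → y ≢ x → (s [ x ↦ₛ v ]) y ≡ s y
updₛ-other s x v y y≢x with y ℕ.≟ x
... | yes y≡x = ⊥-elim (y≢x y≡x)
... | no _ = refl

updₕ-same : ∀ h l v → (h [ l ↦ₕ v ]) l ≡ just v
updₕ-same h l v with l ℤ.≟ l
... | yes _ = refl
... | no l≢l = ⊥-elim (l≢l refl)

updₕ-other : ∀ h l v k → k ≢ l → (h [ l ↦ₕ v ]) k ≡ h k
updₕ-other h l v k k≢l with k ℤ.≟ l
... | yes k≡l = ⊥-elim (k≢l k≡l)
... | no _ = refl

cell : Val → Val → Heap
cell l v = emptyHeap [ l ↦ₕ v ]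

Finite-cell : ∀ l v → Finite (cell l v)
Finite-cell l v = l ∷ [] , dom
  where
  dom : ∀ k w → cell l v k ≡ just w → k ∈ₗ (l ∷ [])
  dom k w _ with k ℤ.≟ l
  dom k w _  | yes k≡l = here k≡l
  dom k w () | no _

⊥ₕ-cell : ∀ a l v → a l ≡ nothing → a ⊥ₕ cell l v
⊥ₕ-cell a l v al k with k ℤ.≟ l
... | yes refl = inj₁ al
... | no _ = inj₂ refl

updₕ≈cell-⊎ₕ : ∀ h l v → (h [ l ↦ₕ v ]) ≈ₕ (cell l v ⊎ₕ h)
updₕ≈cell-⊎ₕ h l v k with k ℤ.≟ l
... | yes _ = refl
... | no _ = refl

IsCellAt : Heap → Val → Set
IsCellAt h l = Σ Val λ w → (h l ≡ just w) × (∀ k → k ≢ l → h k ≡ nothing)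

cell-⊎ₕ-overwrite : ∀ {h₁ l} v Y → IsCellAt h₁ l → (cell l v ⊎ₕ (h₁ ⊎ₕ Y)) ≈ₕ (cell l v ⊎ₕ Y)
cell-⊎ₕ-overwrite {h₁} {l} v Y (_ , _ , h₁-only-l) k with k ℤ.≟ l
... | yes _ = refl
... | no k≢l = ⊎ₕ-nothingˡ h₁ Y (h₁-only-l k k≢l)

∖ₕ-cell : ∀ {h₁ l} Y G → IsCellAt h₁ l → h₁ ⊥ₕ Y → G ≈ₕ (h₁ ⊎ₕ Y) → (G ∖ₕ l) ≈ₕ Y
∖ₕ-cell {h₁} {l} Y G (_ , h₁l , h₁-only-l) h₁⊥Y G≈ k with k ℤ.≟ l
... | no k≢l = trans (G≈ k) (⊎ₕ-nothingˡ h₁ Y (h₁-only-l k k≢l))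
... | yes refl with h₁⊥Y k
...   | inj₁ h₁k = ⊥-elim (just≢nothing (trans (sym h₁l) h₁k))
...   | inj₂ Yk = sym Yk

cells : Val → List Val → Heap
cells l ws = allocAt emptyHeap l ws

allocAt≈cells-⊎ₕ : ∀ ws g l → allocAt g l ws ≈ₕ (cells l ws ⊎ₕ g)
allocAt≈cells-⊎ₕ [] g l k = refl
allocAt≈cells-⊎ₕ (w ∷ ws) g l = begin
  allocAt (g [ l ↦ₕ w ]) l' ws    ≈⟨ allocAt≈cells-⊎ₕ ws (g [ l ↦ₕ w ]) l' ⟩
  cells l' ws ⊎ₕ (g [ l ↦ₕ w ])   ≈⟨ ⊎ₕ-congˡ (cells l' ws) (updₕ≈cell-⊎ₕ g l w) ⟩
  cells l' ws ⊎ₕ (cell l w ⊎ₕ g)  ≈⟨ ⊎ₕ-assoc (cells l' ws) (cell l w) g ⟨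
  (cells l' ws ⊎ₕ cell l w) ⊎ₕ g  ≈⟨ ⊎ₕ-congʳ g (allocAt≈cells-⊎ₕ ws (cell l w) l') ⟨
  cells l (w ∷ ws) ⊎ₕ g           ∎
  where
  open ≈ₕ-Reasoning
  l' = l ℤ.+ ℤ.+ 1

cells-∷ : ∀ w ws l → cells l (w ∷ ws) ≈ₕ (cells (l ℤ.+ ℤ.+ 1) ws ⊎ₕ cell l w)
cells-∷ w ws l = allocAt≈cells-⊎ₕ ws (cell l w) (l ℤ.+ ℤ.+ 1)

i<i+1 : ∀ i → i ℤ.< i ℤ.+ ℤ.+ 1
i<i+1 i = ℤP.suc[i]≤j⇒i<j (ℤP.≤-reflexive (ℤP.+-comm (ℤ.+ 1) i))

cells-below : ∀ ws l k → k ℤ.< l → cells l ws k ≡ nothing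
cells-below [] l k k<l = refl
cells-below (w ∷ ws) l k k<l = begin
  cells l (w ∷ ws) k                      ≡⟨ cells-∷ w ws l k ⟩
  (cells (l ℤ.+ ℤ.+ 1) ws ⊎ₕ cell l w) k  ≡⟨ ⊎ₕ-nothingˡ (cells _ ws) (cell l w) below ⟩
  cell l w k                              ≡⟨ updₕ-other emptyHeap l w k (ℤP.<⇒≢ k<l) ⟩
  nothing                                 ∎
  where
  open ≡-Reasoning
  below = cells-below ws (l ℤ.+ ℤ.+ 1) k (ℤP.<-trans k<l (i<i+1 l))

Finite-cells : ∀ l ws → Finite (cells l ws)
Finite-cells l [] = Finite-empty
Finite-cells l (w ∷ ws) =
  Finite-⊑ₕ (≈ₕ⇒⊑ₕ (cells-∷ w ws l)) (Finite-⊎ₕ (Finite-cells (l ℤ.+ ℤ.+ 1) ws) (Finite-cell l w))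

FreshBlock⇒⊥ₕcells : ∀ ws H l → FreshBlock H l (List.length ws) → H ⊥ₕ cells l ws
FreshBlock⇒⊥ₕcells [] H l _ k = inj₂ refl
FreshBlock⇒⊥ₕcells (w ∷ ws) H l (Hl , fresh) =
  ⊥ₕ-respʳ (≈ₕ-sym (cells-∷ w ws l))
    (⊥ₕ-⊎ʳ (FreshBlock⇒⊥ₕcells ws H (l ℤ.+ ℤ.+ 1) fresh) (⊥ₕ-cell H l w Hl))

cells-↦⋯ : ∀ es e t → t , cells (⟦ e ⟧ₑ t) (List.map (λ e' → ⟦ e' ⟧ₑ t) es) ⊨ (e ↦⋯ es)
cells-↦⋯ [] e t k = refl
cells-↦⋯ (e₁ ∷ es) e t =
  cell l w , rest , cell⊥rest ,
  ≈ₕ-trans (cells-∷ w ws l) (⊎ₕ-comm rest (cell l w) (⊥ₕ-sym cell⊥rest)) ,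
  (updₕ-same emptyHeap l w , updₕ-other emptyHeap l w) ,
  cells-↦⋯ es (e ⊕ lit (ℤ.+ 1)) t
  where
  l = ⟦ e ⟧ₑ t
  w = ⟦ e₁ ⟧ₑ t
  ws = List.map (λ e' → ⟦ e' ⟧ₑ t) es
  rest = cells (l ℤ.+ ℤ.+ 1) ws
  cell⊥rest : cell l w ⊥ₕ rest
  cell⊥rest = ⊥ₕ-sym (⊥ₕ-cell rest l w (cells-below ws (l ℤ.+ ℤ.+ 1) l (i<i+1 l)))

-- Free variables and substitution

++-restrictˡ : ∀ {P : Var → Set} {xs ys} → (∀ z → z ∈ₗ xs ++ ys → P z) → ∀ z → z ∈ₗ xs → P z
++-restrictˡ f z z∈xs = f z (∈-++⁺ˡ z∈xs)

++-restrictʳ : ∀ {P : Var → Set} xs {ys} → (∀ z → z ∈ₗ xs ++ ys → P z) → ∀ z → z ∈ₗ ys → P z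
++-restrictʳ xs f z z∈ys = f z (∈-++⁺ʳ xs z∈ys)

⟦⟧ₑ-agree : ∀ e {s t} → (∀ z → z ∈FVₑ e → s z ≡ t z) → ⟦ e ⟧ₑ s ≡ ⟦ e ⟧ₑ t
⟦⟧ₑ-agree (var x) ag = ag x (here refl)
⟦⟧ₑ-agree (lit n) ag = refl
⟦⟧ₑ-agree (a ⊕ b) ag = cong₂ ℤ._+_ (⟦⟧ₑ-agree a (++-restrictˡ ag)) (⟦⟧ₑ-agree b (++-restrictʳ (fvE a) ag))
⟦⟧ₑ-agree (a ⊖ b) ag = cong₂ ℤ._-_ (⟦⟧ₑ-agree a (++-restrictˡ ag)) (⟦⟧ₑ-agree b (++-restrictʳ (fvE a) ag))
⟦⟧ₑ-agree (a ⊗ b) ag = cong₂ ℤ._*_ (⟦⟧ₑ-agree a (++-restrictˡ ag)) (⟦⟧ₑ-agree b (++-restrictʳ (fvE a) ag))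

map-⟦⟧ₑ-agree : ∀ es {s t} → (∀ z → z ∈ₗ List.concatMap fvE es → s z ≡ t z) →
  List.map (λ e → ⟦ e ⟧ₑ s) es ≡ List.map (λ e → ⟦ e ⟧ₑ t) es
map-⟦⟧ₑ-agree [] ag = refl
map-⟦⟧ₑ-agree (e ∷ es) ag =
  cong₂ _∷_ (⟦⟧ₑ-agree e (++-restrictˡ ag)) (map-⟦⟧ₑ-agree es (++-restrictʳ (fvE e) ag))

⊨-resp-≈ₕ : ∀ P {s h h'} → h ≈ₕ h' → s , h ⊨ P → s , h' ⊨ P
⊨-resp-≈ₕ ttA h≈ p = p
⊨-resp-≈ₕ ffA h≈ p = p
⊨-resp-≈ₕ (a ≐ b) h≈ p = p
⊨-resp-≈ₕ (a ≤ₐ b) h≈ p = p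
⊨-resp-≈ₕ emp h≈ p l = trans (sym (h≈ l)) (p l)
⊨-resp-≈ₕ (a ↦ b) h≈ (pt , only) = trans (sym (h≈ _)) pt , λ l l≢ → trans (sym (h≈ l)) (only l l≢)
⊨-resp-≈ₕ (P ∧ₐ Q) h≈ (p , q) = ⊨-resp-≈ₕ P h≈ p , ⊨-resp-≈ₕ Q h≈ q
⊨-resp-≈ₕ (P ∨ₐ Q) h≈ (inj₁ p) = inj₁ (⊨-resp-≈ₕ P h≈ p)
⊨-resp-≈ₕ (P ∨ₐ Q) h≈ (inj₂ q) = inj₂ (⊨-resp-≈ₕ Q h≈ q)
⊨-resp-≈ₕ (P ⇒ₐ Q) h≈ f p = ⊨-resp-≈ₕ Q h≈ (f (⊨-resp-≈ₕ P (≈ₕ-sym h≈) p))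
⊨-resp-≈ₕ (∀ₐ x P) h≈ f v = ⊨-resp-≈ₕ P h≈ (f v)
⊨-resp-≈ₕ (∃ₐ x P) h≈ (v , p) = v , ⊨-resp-≈ₕ P h≈ p
⊨-resp-≈ₕ (P ∗ Q) h≈ (h₁ , h₂ , d , h≈h₁h₂ , p , q) = h₁ , h₂ , d , ≈ₕ-trans (≈ₕ-sym h≈) h≈h₁h₂ , p , q
⊨-resp-≈ₕ (P −∗ Q) h≈ f g fin d p =
  ⊨-resp-≈ₕ Q (⊎ₕ-congʳ g h≈) (f g fin (⊥ₕ-respˡ (≈ₕ-sym h≈) d) p)

agree-updₛ : ∀ {P : Assert} {s t y} v → (∀ z → (z ≢ y) × (z ∈FV P) → s z ≡ t z) →
  ∀ z → z ∈FV P → (s [ y ↦ₛ v ]) z ≡ (t [ y ↦ₛ v ]) z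
agree-updₛ {y = y} v ag z z∈P with z ℕ.≟ y
... | yes _ = refl
... | no z≢y = ag z (z≢y , z∈P)

⊨-resp-agree : ∀ P {s t h} → (∀ z → z ∈FV P → s z ≡ t z) → s , h ⊨ P → t , h ⊨ P
⊨-resp-agree ttA ag p = p
⊨-resp-agree ffA ag p = p
⊨-resp-agree (a ≐ b) ag p =
  trans (sym (⟦⟧ₑ-agree a (λ z → ag z ∘ inj₁))) (trans p (⟦⟧ₑ-agree b (λ z → ag z ∘ inj₂)))
⊨-resp-agree (a ≤ₐ b) ag p =
  subst₂ ℤ._≤_ (⟦⟧ₑ-agree a (λ z → ag z ∘ inj₁)) (⟦⟧ₑ-agree b (λ z → ag z ∘ inj₂)) p
⊨-resp-agree emp ag p = p
⊨-resp-agree (a ↦ b) {h = h} ag (pt , only) =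
  subst₂ (λ l v → h l ≡ just v) a≡ b≡ pt , λ l l≢ → only l (λ l≡ → l≢ (trans l≡ a≡))
  where
  a≡ = ⟦⟧ₑ-agree a (λ z → ag z ∘ inj₁)
  b≡ = ⟦⟧ₑ-agree b (λ z → ag z ∘ inj₂)
⊨-resp-agree (P ∧ₐ Q) ag (p , q) = ⊨-resp-agree P (λ z → ag z ∘ inj₁) p , ⊨-resp-agree Q (λ z → ag z ∘ inj₂) q
⊨-resp-agree (P ∨ₐ Q) ag (inj₁ p) = inj₁ (⊨-resp-agree P (λ z → ag z ∘ inj₁) p)
⊨-resp-agree (P ∨ₐ Q) ag (inj₂ q) = inj₂ (⊨-resp-agree Q (λ z → ag z ∘ inj₂) q)
⊨-resp-agree (P ⇒ₐ Q) ag f p =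
  ⊨-resp-agree Q (λ z → ag z ∘ inj₂) (f (⊨-resp-agree P (λ z → sym ∘ ag z ∘ inj₁) p))
⊨-resp-agree (∀ₐ y P) ag f v = ⊨-resp-agree P (agree-updₛ {P} v ag) (f v)
⊨-resp-agree (∃ₐ y P) ag (v , p) = v , ⊨-resp-agree P (agree-updₛ {P} v ag) p
⊨-resp-agree (P ∗ Q) ag (h₁ , h₂ , d , eq , p , q) =
  h₁ , h₂ , d , eq , ⊨-resp-agree P (λ z → ag z ∘ inj₁) p , ⊨-resp-agree Q (λ z → ag z ∘ inj₂) q
⊨-resp-agree (P −∗ Q) ag f g fin d p =
  ⊨-resp-agree Q (λ z → ag z ∘ inj₂) (f g fin d (⊨-resp-agree P (λ z → sym ∘ ag z ∘ inj₁) p))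

∈⇒≤maxL : ∀ {w xs} → w ∈ₗ xs → w ℕ.≤ maxL xs
∈⇒≤maxL {xs = x ∷ xs} (here refl) = ℕP.m≤m⊔n x (maxL xs)
∈⇒≤maxL {xs = x ∷ xs} (there w∈xs) = ℕP.≤-trans (∈⇒≤maxL w∈xs) (ℕP.m≤n⊔m x (maxL xs))

freshFor-∉ : ∀ {w xs} → w ∈ₗ xs → w ≢ freshFor xs
freshFor-∉ w∈xs refl = ℕP.<-irrefl refl (ℕ.s≤s (∈⇒≤maxL w∈xs))

⟦substE⟧ₑ : ∀ e σ {s t} → (∀ z → z ∈FVₑ e → ⟦ σ z ⟧ₑ s ≡ t z) → ⟦ substE σ e ⟧ₑ s ≡ ⟦ e ⟧ₑ t
⟦substE⟧ₑ (var x) σ ag = ag x (here refl)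
⟦substE⟧ₑ (lit n) σ ag = refl
⟦substE⟧ₑ (a ⊕ b) σ ag =
  cong₂ ℤ._+_ (⟦substE⟧ₑ a σ (++-restrictˡ ag)) (⟦substE⟧ₑ b σ (++-restrictʳ (fvE a) ag))
⟦substE⟧ₑ (a ⊖ b) σ ag =
  cong₂ ℤ._-_ (⟦substE⟧ₑ a σ (++-restrictˡ ag)) (⟦substE⟧ₑ b σ (++-restrictʳ (fvE a) ag))
⟦substE⟧ₑ (a ⊗ b) σ ag =
  cong₂ ℤ._*_ (⟦substE⟧ₑ a σ (++-restrictˡ ag)) (⟦substE⟧ₑ b σ (++-restrictʳ (fvE a) ag))

-- Over varsA rather than FV: substA names each binder apart from the variables of σ z for z ∈ varsA P.
SubstAgree : Assert → (Var → Exp) → Store → Store → Set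
SubstAgree P σ s t = ∀ z → z ∈ₗ varsA P → ⟦ σ z ⟧ₑ s ≡ t z

substA-binder : Var → Assert → (Var → Exp) → Var
substA-binder x P σ = freshFor (x ∷ varsA P ++ List.concatMap (λ z → fvE (σ z)) (varsA P))

SubstAgree-binder : ∀ x P σ s t v → SubstAgree (∀ₐ x P) σ s t →
  SubstAgree P (updσ σ x (var (substA-binder x P σ))) (s [ substA-binder x P σ ↦ₛ v ]) (t [ x ↦ₛ v ])
SubstAgree-binder x P σ s t v ag z z∈P with z ℕ.≟ x
... | yes _ = updₛ-same s (substA-binder x P σ) v
... | no _ = trans (⟦⟧ₑ-agree (σ z) (λ w w∈σz → updₛ-other s _ v w (binder-fresh w∈σz))) (ag z (there z∈P))
  where
  binder-fresh : ∀ {w} → w ∈FVₑ σ z → w ≢ substA-binder x P σ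
  binder-fresh w∈σz = freshFor-∉ (there (∈-++⁺ʳ (varsA P) (∈-concatMap⁺ (λ u → fvE (σ u)) (lose z∈P w∈σz))))

⊨-substA⇒ : ∀ P σ {s t h} → SubstAgree P σ s t → s , h ⊨ substA σ P → t , h ⊨ P
⊨-substA⇐ : ∀ P σ {s t h} → SubstAgree P σ s t → t , h ⊨ P → s , h ⊨ substA σ P

⊨-substA⇒ ttA σ ag p = p
⊨-substA⇒ ffA σ ag p = p
⊨-substA⇒ (a ≐ b) σ ag p =
  trans (sym (⟦substE⟧ₑ a σ (++-restrictˡ ag))) (trans p (⟦substE⟧ₑ b σ (++-restrictʳ (fvE a) ag)))
⊨-substA⇒ (a ≤ₐ b) σ ag p =
  subst₂ ℤ._≤_ (⟦substE⟧ₑ a σ (++-restrictˡ ag)) (⟦substE⟧ₑ b σ (++-restrictʳ (fvE a) ag)) p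
⊨-substA⇒ emp σ ag p = p
⊨-substA⇒ (a ↦ b) σ {h = h} ag (pt , only) =
  subst₂ (λ l v → h l ≡ just v) a≡ b≡ pt , λ l l≢ → only l (λ l≡ → l≢ (trans l≡ a≡))
  where
  a≡ = ⟦substE⟧ₑ a σ (++-restrictˡ ag)
  b≡ = ⟦substE⟧ₑ b σ (++-restrictʳ (fvE a) ag)
⊨-substA⇒ (P ∧ₐ Q) σ ag (p , q) =
  ⊨-substA⇒ P σ (++-restrictˡ ag) p , ⊨-substA⇒ Q σ (++-restrictʳ (varsA P) ag) q
⊨-substA⇒ (P ∨ₐ Q) σ ag (inj₁ p) = inj₁ (⊨-substA⇒ P σ (++-restrictˡ ag) p)
⊨-substA⇒ (P ∨ₐ Q) σ ag (inj₂ q) = inj₂ (⊨-substA⇒ Q σ (++-restrictʳ (varsA P) ag) q)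
⊨-substA⇒ (P ⇒ₐ Q) σ ag f p =
  ⊨-substA⇒ Q σ (++-restrictʳ (varsA P) ag) (f (⊨-substA⇐ P σ (++-restrictˡ ag) p))
⊨-substA⇒ (∀ₐ x P) σ {s} {t} ag f v = ⊨-substA⇒ P _ (SubstAgree-binder x P σ s t v ag) (f v)
⊨-substA⇒ (∃ₐ x P) σ {s} {t} ag (v , p) = v , ⊨-substA⇒ P _ (SubstAgree-binder x P σ s t v ag) p
⊨-substA⇒ (P ∗ Q) σ ag (h₁ , h₂ , d , eq , p , q) =
  h₁ , h₂ , d , eq , ⊨-substA⇒ P σ (++-restrictˡ ag) p , ⊨-substA⇒ Q σ (++-restrictʳ (varsA P) ag) q
⊨-substA⇒ (P −∗ Q) σ ag f g fin d p =
  ⊨-substA⇒ Q σ (++-restrictʳ (varsA P) ag) (f g fin d (⊨-substA⇐ P σ (++-restrictˡ ag) p))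

⊨-substA⇐ ttA σ ag p = p
⊨-substA⇐ ffA σ ag p = p
⊨-substA⇐ (a ≐ b) σ ag p =
  trans (⟦substE⟧ₑ a σ (++-restrictˡ ag)) (trans p (sym (⟦substE⟧ₑ b σ (++-restrictʳ (fvE a) ag))))
⊨-substA⇐ (a ≤ₐ b) σ ag p =
  subst₂ ℤ._≤_ (sym (⟦substE⟧ₑ a σ (++-restrictˡ ag))) (sym (⟦substE⟧ₑ b σ (++-restrictʳ (fvE a) ag))) p
⊨-substA⇐ emp σ ag p = p
⊨-substA⇐ (a ↦ b) σ {h = h} ag (pt , only) =
  subst₂ (λ l v → h l ≡ just v) (sym a≡) (sym b≡) pt , λ l l≢ → only l (λ l≡ → l≢ (trans l≡ (sym a≡)))
  where
  a≡ = ⟦substE⟧ₑ a σ (++-restrictˡ ag)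
  b≡ = ⟦substE⟧ₑ b σ (++-restrictʳ (fvE a) ag)
⊨-substA⇐ (P ∧ₐ Q) σ ag (p , q) =
  ⊨-substA⇐ P σ (++-restrictˡ ag) p , ⊨-substA⇐ Q σ (++-restrictʳ (varsA P) ag) q
⊨-substA⇐ (P ∨ₐ Q) σ ag (inj₁ p) = inj₁ (⊨-substA⇐ P σ (++-restrictˡ ag) p)
⊨-substA⇐ (P ∨ₐ Q) σ ag (inj₂ q) = inj₂ (⊨-substA⇐ Q σ (++-restrictʳ (varsA P) ag) q)
⊨-substA⇐ (P ⇒ₐ Q) σ ag f p =
  ⊨-substA⇐ Q σ (++-restrictʳ (varsA P) ag) (f (⊨-substA⇒ P σ (++-restrictˡ ag) p))
⊨-substA⇐ (∀ₐ x P) σ {s} {t} ag f v = ⊨-substA⇐ P _ (SubstAgree-binder x P σ s t v ag) (f v)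
⊨-substA⇐ (∃ₐ x P) σ {s} {t} ag (v , p) = v , ⊨-substA⇐ P _ (SubstAgree-binder x P σ s t v ag) p
⊨-substA⇐ (P ∗ Q) σ ag (h₁ , h₂ , d , eq , p , q) =
  h₁ , h₂ , d , eq , ⊨-substA⇐ P σ (++-restrictˡ ag) p , ⊨-substA⇐ Q σ (++-restrictʳ (varsA P) ag) q
⊨-substA⇐ (P −∗ Q) σ ag f g fin d p =
  ⊨-substA⇐ Q σ (++-restrictʳ (varsA P) ag) (f g fin d (⊨-substA⇒ P σ (++-restrictˡ ag) p))

updσ-var-⟦⟧ₑ : ∀ x e s z → ⟦ updσ var x e z ⟧ₑ s ≡ (s [ x ↦ₛ ⟦ e ⟧ₑ s ]) z
updσ-var-⟦⟧ₑ x e s z with z ℕ.≟ x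
... | yes _ = refl
... | no _ = refl

⊨-[var/] : ∀ Q x v s w u {h} → (s [ v ↦ₛ w ]) v ≡ u → (∀ z → z ∈FV Q → z ≢ x → z ≢ v) →
  (s [ v ↦ₛ w ]) , h ⊨ (Q [ var v / x ]) → (s [ x ↦ₛ u ]) , h ⊨ Q
⊨-[var/] Q x v s w u v↦u v-fresh p = ⊨-resp-agree Q ag (⊨-substA⇒ Q (updσ var x (var v)) (λ _ _ → refl) p)
  where
  ag : ∀ z → z ∈FV Q → ⟦ updσ var x (var v) z ⟧ₑ (s [ v ↦ₛ w ]) ≡ (s [ x ↦ₛ u ]) z
  ag z z∈Q with z ℕ.≟ x
  ... | yes _ = v↦u
  ... | no z≢x = updₛ-other s v w z (v-fresh z z∈Q z≢x)

-- Basic commands and soundness of separation logic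

_∈mod?_ : ∀ z c → Dec (z ∈mod c)
z ∈mod? (x ≔ e) = z ℕ.≟ x
z ∈mod? (x ≔[ e ]) = z ℕ.≟ x
z ∈mod? ([ e ]≔ e') = no λ ()
z ∈mod? (x ≔cons es) = z ℕ.≟ x
z ∈mod? dispose e = no λ ()

⇓-unmodified : ∀ {c s H s' ĥ} → ⟦ c ⟧ s , H ⇓ ok s' ĥ → ∀ z → ¬ (z ∈mod c) → s' z ≡ s z
⇓-unmodified {s = s} (assign {x}) z z∉ = updₛ-other s x _ z z∉
⇓-unmodified {s = s} (lookup-ok {x} _) z z∉ = updₛ-other s x _ z z∉
⇓-unmodified (mutate-ok _) z z∉ = refl
⇓-unmodified {s = s} (cons-ok {x} _) z z∉ = updₛ-other s x _ z z∉
⇓-unmodified (dispose-ok _) z z∉ = refl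

⇓abort-agree : ∀ {c s t H} → (∀ z → z ∈FVc c → s z ≡ t z) → ⟦ c ⟧ s , H ⇓ abort → ⟦ c ⟧ t , H ⇓ abort
⇓abort-agree {H = H} ag (lookup-ab {e = e} He) =
  lookup-ab (subst (λ l → H l ≡ nothing) (⟦⟧ₑ-agree e (λ z → ag z ∘ inj₂)) He)
⇓abort-agree {H = H} ag (mutate-ab {e = e} He) =
  mutate-ab (subst (λ l → H l ≡ nothing) (⟦⟧ₑ-agree e (λ z → ag z ∘ inj₁)) He)
⇓abort-agree {H = H} ag (dispose-ab {e = e} He) =
  dispose-ab (subst (λ l → H l ≡ nothing) (⟦⟧ₑ-agree e ag) He)

⇓ok-agree : ∀ {c s t H s' ĥ} → (∀ z → z ∈FVc c → s z ≡ t z) → ⟦ c ⟧ s , H ⇓ ok s' ĥ →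
  Σ Store λ t' → (⟦ c ⟧ t , H ⇓ ok t' ĥ) × (∀ z → z ∈mod c → s' z ≡ t' z)
⇓ok-agree {s = s} {t} ag (assign {x} {e}) =
  t [ x ↦ₛ ⟦ e ⟧ₑ t ] , assign ,
  λ { z refl → trans (updₛ-same s x _) (trans (⟦⟧ₑ-agree e (λ z → ag z ∘ inj₂)) (sym (updₛ-same t x _))) }
⇓ok-agree {s = s} {t} {H} ag (lookup-ok {x} {e} {v = v} He) =
  t [ x ↦ₛ v ] , lookup-ok (subst (λ l → H l ≡ just v) (⟦⟧ₑ-agree e (λ z → ag z ∘ inj₂)) He) ,
  λ { z refl → trans (updₛ-same s x _) (sym (updₛ-same t x _)) }
⇓ok-agree {t = t} {H} ag (mutate-ok {e} {e'} {v = v} He) =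
  t , subst₂ (λ l v' → ⟦ [ e ]≔ e' ⟧ t , H ⇓ ok t (H [ l ↦ₕ v' ])) (sym e≡) (sym e'≡)
        (mutate-ok (subst (λ l → H l ≡ just v) e≡ He)) ,
  λ z ()
  where
  e≡ = ⟦⟧ₑ-agree e (λ z → ag z ∘ inj₁)
  e'≡ = ⟦⟧ₑ-agree e' (λ z → ag z ∘ inj₂)
⇓ok-agree {s = s} {t} {H} ag (cons-ok {x} {es} {l = l} fresh) =
  t [ x ↦ₛ l ] ,
  subst (λ ws → ⟦ x ≔cons es ⟧ t , H ⇓ ok (t [ x ↦ₛ l ]) (allocAt H l ws))
    (sym (map-⟦⟧ₑ-agree es (λ z → ag z ∘ inj₂))) (cons-ok fresh) ,
  λ { z refl → trans (updₛ-same s x _) (sym (updₛ-same t x _)) }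
⇓ok-agree {t = t} {H} ag (dispose-ok {e} {v = v} He) =
  t , subst (λ l → ⟦ dispose e ⟧ t , H ⇓ ok t (H ∖ₕ l)) (sym e≡)
        (dispose-ok (subst (λ l → H l ≡ just v) e≡ He)) ,
  λ z ()
  where
  e≡ = ⟦⟧ₑ-agree e ag

WithFrame : Store → Heap → Heap → Assert → Set
WithFrame s ĥ hF Q = Σ Heap λ h → Finite h × (h ⊥ₕ hF) × (ĥ ≈ₕ (h ⊎ₕ hF)) × (s , h ⊨ Q)

-- Fault avoidance and the frame property at once: c runs on a P-heap extended by any frame hF,
-- which it leaves untouched.
⊨SL⟨_⟩_⟨_⟩ : Assert → BCmd → Assert → Set
⊨SL⟨ P ⟩ c ⟨ Q ⟩ = ∀ s h → Finite h → s , h ⊨ P → ∀ hF H → h ⊥ₕ hF → H ≈ₕ (h ⊎ₕ hF) →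
  (¬ (⟦ c ⟧ s , H ⇓ abort)) × (∀ s' ĥ → ⟦ c ⟧ s , H ⇓ ok s' ĥ → WithFrame s' ĥ hF Q)

⊨SL-pre : ∀ {P P' c Q} → P ⊨ₑ P' → ⊨SL⟨ P' ⟩ c ⟨ Q ⟩ → ⊨SL⟨ P ⟩ c ⟨ Q ⟩
⊨SL-pre P⊨P' valid s h fin p = valid s h fin (P⊨P' s h fin p)

⊨SL-post : ∀ {P c Q Q'} → Q ⊨ₑ Q' → ⊨SL⟨ P ⟩ c ⟨ Q ⟩ → ⊨SL⟨ P ⟩ c ⟨ Q' ⟩
⊨SL-post Q⊨Q' valid s h fin p hF H d H≈ with valid s h fin p hF H d H≈
... | safe , post = safe , λ s' ĥ ⇓ok → let (h' , fin' , d' , ĥ≈ , q) = post s' ĥ ⇓ok in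
                                          h' , fin' , d' , ĥ≈ , Q⊨Q' s' h' fin' q

↦−⇒IsCellAt : ∀ e s h → s , h ⊨ (e ↦−) → IsCellAt h (⟦ e ⟧ₑ s)
↦−⇒IsCellAt e s h (w , pt , only) =
  s' v , subst (λ l → h l ≡ just (s' v)) e≡ pt , λ k k≢ → only k (λ k≡ → k≢ (trans k≡ e≡))
  where
  v = freshFor (fvE e)
  s' = s [ v ↦ₛ w ]
  e≡ : ⟦ e ⟧ₑ s' ≡ ⟦ e ⟧ₑ s
  e≡ = ⟦⟧ₑ-agree e (λ z z∈e → updₛ-other s _ w z (freshFor-∉ z∈e))

⊨SL-assign : ∀ x e Q → ⊨SL⟨ Q [ e / x ] ⟩ (x ≔ e) ⟨ Q ⟩
⊨SL-assign x e Q s h fin p hF H d H≈ = (λ ()) , post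
  where
  post : ∀ s' ĥ → ⟦ x ≔ e ⟧ s , H ⇓ ok s' ĥ → WithFrame s' ĥ hF Q
  post _ _ assign = h , fin , d , H≈ , ⊨-substA⇒ Q (updσ var x e) (λ z _ → updσ-var-⟦⟧ₑ x e s z) p

⊨SL-lookup : ∀ x e Q v → ¬ (v ∈FVₑ e) → (v ∈FV Q → v ≡ x) →
  ⊨SL⟨ ∃ₐ v ((e ↦ var v) ∗ ((e ↦ var v) −∗ (Q [ var v / x ]))) ⟩ (x ≔[ e ]) ⟨ Q ⟩
⊨SL-lookup x e Q v v∉e v∈Q s h fin (w , h₁ , h₂ , h₁⊥h₂ , h≈ , (pt , only) , wand) hF H d H≈ = safe , post
  where
  s₁ = s [ v ↦ₛ w ]
  e≡ : ⟦ e ⟧ₑ s₁ ≡ ⟦ e ⟧ₑ s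
  e≡ = ⟦⟧ₑ-agree e (λ z z∈e → updₛ-other s v w z (λ { refl → v∉e z∈e }))
  H-at-e : H (⟦ e ⟧ₑ s) ≡ just (s₁ v)
  H-at-e = trans (⊎ₕ-regroup h₁ h₂ hF H≈ h≈ _)
             (⊎ₕ-just h₁ (h₂ ⊎ₕ hF) (subst (λ l → h₁ l ≡ just (s₁ v)) e≡ pt))
  safe : ¬ (⟦ x ≔[ e ] ⟧ s , H ⇓ abort)
  safe (lookup-ab H-at-e≡nothing) = just≢nothing (trans (sym H-at-e) H-at-e≡nothing)
  post : ∀ s' ĥ → ⟦ x ≔[ e ] ⟧ s , H ⇓ ok s' ĥ → WithFrame s' ĥ hF Q
  post _ _ (lookup-ok {v = u} H-at-e≡u) =
    h , fin , d , H≈ ,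
    ⊨-[var/] Q x v s w u (just-injective (trans (sym H-at-e) H-at-e≡u))
      (λ { z z∈Q z≢x refl → z≢x (v∈Q z∈Q) })
      (⊨-resp-≈ₕ (Q [ var v / x ]) (≈ₕ-trans (⊎ₕ-comm h₂ h₁ (⊥ₕ-sym h₁⊥h₂)) (≈ₕ-sym h≈))
        (wand h₁ (Finite-⊑ₕ (split-⊑ˡ h≈) fin) (⊥ₕ-sym h₁⊥h₂) (pt , only)))

⊨SL-mutate : ∀ e e' Q → ⊨SL⟨ (e ↦−) ∗ ((e ↦ e') −∗ Q) ⟩ ([ e ]≔ e') ⟨ Q ⟩
⊨SL-mutate e e' Q s h fin (h₁ , h₂ , h₁⊥h₂ , h≈ , e↦− , wand) hF H d H≈ = safe , post
  where
  l = ⟦ e ⟧ₑ s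
  v' = ⟦ e' ⟧ₑ s
  isCell = ↦−⇒IsCellAt e s h₁ e↦−
  h₁l = proj₁ (proj₂ isCell)
  H-at-l : H l ≡ just (proj₁ isCell)
  H-at-l = trans (⊎ₕ-regroup h₁ h₂ hF H≈ h≈ l) (⊎ₕ-just h₁ (h₂ ⊎ₕ hF) h₁l)
  free-at-l : ∀ {g} → h₁ ⊥ₕ g → g l ≡ nothing
  free-at-l h₁⊥g with h₁⊥g l
  ... | inj₁ h₁l≡nothing = ⊥-elim (just≢nothing (trans (sym h₁l) h₁l≡nothing))
  ... | inj₂ gl = gl
  h₂⊑h = split-⊑ʳ h₁⊥h₂ h≈
  h₂⊥cell : h₂ ⊥ₕ cell l v'
  h₂⊥cell = ⊥ₕ-cell h₂ l v' (free-at-l h₁⊥h₂)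
  safe : ¬ (⟦ [ e ]≔ e' ⟧ s , H ⇓ abort)
  safe (mutate-ab H-at-l≡nothing) = just≢nothing (trans (sym H-at-l) H-at-l≡nothing)
  H'≈ : (H [ l ↦ₕ v' ]) ≈ₕ ((h₂ ⊎ₕ cell l v') ⊎ₕ hF)
  H'≈ = begin
    H [ l ↦ₕ v' ]                  ≈⟨ updₕ≈cell-⊎ₕ H l v' ⟩
    cell l v' ⊎ₕ H                 ≈⟨ ⊎ₕ-congˡ (cell l v') (⊎ₕ-regroup h₁ h₂ hF H≈ h≈) ⟩
    cell l v' ⊎ₕ (h₁ ⊎ₕ (h₂ ⊎ₕ hF)) ≈⟨ cell-⊎ₕ-overwrite v' (h₂ ⊎ₕ hF) isCell ⟩
    cell l v' ⊎ₕ (h₂ ⊎ₕ hF)         ≈⟨ ⊎ₕ-assoc (cell l v') h₂ hF ⟨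
    (cell l v' ⊎ₕ h₂) ⊎ₕ hF         ≈⟨ ⊎ₕ-congʳ hF (⊎ₕ-comm (cell l v') h₂ (⊥ₕ-sym h₂⊥cell)) ⟩
    (h₂ ⊎ₕ cell l v') ⊎ₕ hF         ∎
    where open ≈ₕ-Reasoning
  post : ∀ s' ĥ → ⟦ [ e ]≔ e' ⟧ s , H ⇓ ok s' ĥ → WithFrame s' ĥ hF Q
  post _ _ (mutate-ok _) =
    h₂ ⊎ₕ cell l v' , Finite-⊎ₕ (Finite-⊑ₕ h₂⊑h fin) (Finite-cell l v') ,
    ⊥ₕ-⊎ˡ (⊑ₕ-⊥ₕ h₂⊑h d) (⊥ₕ-sym (⊥ₕ-cell hF l v' (free-at-l (⊑ₕ-⊥ₕ (split-⊑ˡ h≈) d)))) ,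
    H'≈ ,
    wand (cell l v') (Finite-cell l v') h₂⊥cell (updₕ-same emptyHeap l v' , updₕ-other emptyHeap l v')

⊨SL-dispose : ∀ e Q → ⊨SL⟨ (e ↦−) ∗ Q ⟩ (dispose e) ⟨ Q ⟩
⊨SL-dispose e Q s h fin (h₁ , h₂ , h₁⊥h₂ , h≈ , e↦− , q) hF H d H≈ = safe , post
  where
  l = ⟦ e ⟧ₑ s
  isCell = ↦−⇒IsCellAt e s h₁ e↦−
  H-at-l : H l ≡ just (proj₁ isCell)
  H-at-l = trans (⊎ₕ-regroup h₁ h₂ hF H≈ h≈ l) (⊎ₕ-just h₁ (h₂ ⊎ₕ hF) (proj₁ (proj₂ isCell)))
  h₂⊑h = split-⊑ʳ h₁⊥h₂ h≈
  safe : ¬ (⟦ dispose e ⟧ s , H ⇓ abort)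
  safe (dispose-ab H-at-l≡nothing) = just≢nothing (trans (sym H-at-l) H-at-l≡nothing)
  post : ∀ s' ĥ → ⟦ dispose e ⟧ s , H ⇓ ok s' ĥ → WithFrame s' ĥ hF Q
  post _ _ (dispose-ok _) =
    h₂ , Finite-⊑ₕ h₂⊑h fin , ⊑ₕ-⊥ₕ h₂⊑h d ,
    ∖ₕ-cell (h₂ ⊎ₕ hF) H isCell (⊥ₕ-⊎ʳ h₁⊥h₂ (⊑ₕ-⊥ₕ (split-⊑ˡ h≈) d)) (⊎ₕ-regroup h₁ h₂ hF H≈ h≈) , q

⊨SL-cons : ∀ x es Q v → ¬ (v ∈ₗ List.concatMap fvE es) → ¬ (v ∈FV Q) →
  ⊨SL⟨ ∀ₐ v ((var v ↦⋯ es) −∗ (Q [ var v / x ])) ⟩ (x ≔cons es) ⟨ Q ⟩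
⊨SL-cons x es Q v v∉es v∉Q s h fin p hF H d H≈ = (λ ()) , post
  where
  post : ∀ s' ĥ → ⟦ x ≔cons es ⟧ s , H ⇓ ok s' ĥ → WithFrame s' ĥ hF Q
  post _ _ (cons-ok {l = l} fresh) =
    h ⊎ₕ B , Finite-⊎ₕ fin (Finite-cells l ws) , ⊥ₕ-⊎ˡ d (⊥ₕ-sym hF⊥B) , H'≈ ,
    ⊨-[var/] Q x v s l l (updₛ-same s v l) (λ { z z∈Q _ refl → v∉Q z∈Q })
      (p l B (Finite-cells l ws) h⊥B B⊨es)
    where
    ws = List.map (λ e → ⟦ e ⟧ₑ s) es
    B = cells l ws
    s₁ = s [ v ↦ₛ l ]
    H⊥B : H ⊥ₕ B
    H⊥B = FreshBlock⇒⊥ₕcells ws H l (subst (FreshBlock H l) (sym (length-map _ es)) fresh)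
    h⊥B : h ⊥ₕ B
    h⊥B = ⊑ₕ-⊥ₕ (split-⊑ˡ H≈) H⊥B
    hF⊥B : hF ⊥ₕ B
    hF⊥B = ⊑ₕ-⊥ₕ (split-⊑ʳ d H≈) H⊥B
    B⊨es : s₁ , B ⊨ (var v ↦⋯ es)
    B⊨es = subst₂ (λ l' ws' → s₁ , cells l' ws' ⊨ (var v ↦⋯ es)) (updₛ-same s v l)
             (map-⟦⟧ₑ-agree es (λ z z∈es → updₛ-other s v l z (λ { refl → v∉es z∈es })))
             (cells-↦⋯ es (var v) s₁)
    H'≈ : allocAt H l ws ≈ₕ ((h ⊎ₕ B) ⊎ₕ hF)
    H'≈ = begin
      allocAt H l ws   ≈⟨ allocAt≈cells-⊎ₕ ws H l ⟩
      B ⊎ₕ H           ≈⟨ ⊎ₕ-congˡ B H≈ ⟩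
      B ⊎ₕ (h ⊎ₕ hF)   ≈⟨ ⊎ₕ-assoc B h hF ⟨
      (B ⊎ₕ h) ⊎ₕ hF   ≈⟨ ⊎ₕ-congʳ hF (⊎ₕ-comm B h (⊥ₕ-sym h⊥B)) ⟩
      (h ⊎ₕ B) ⊎ₕ hF   ∎
      where open ≈ₕ-Reasoning

⊨SL-frame : ∀ {P c Q} R → ⊨SL⟨ P ⟩ c ⟨ Q ⟩ → (∀ x → x ∈mod c → ¬ (x ∈FV R)) → ⊨SL⟨ P ∗ R ⟩ c ⟨ Q ∗ R ⟩
⊨SL-frame {c = c} {Q} R valid R-unmod s h fin (h₁ , h₂ , h₁⊥h₂ , h≈ , p , r) hF H d H≈ = safe , post
  where
  h₂⊑h = split-⊑ʳ h₁⊥h₂ h≈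
  inner = valid s h₁ (Finite-⊑ₕ (split-⊑ˡ h≈) fin) p (h₂ ⊎ₕ hF) H
            (⊥ₕ-⊎ʳ h₁⊥h₂ (⊑ₕ-⊥ₕ (split-⊑ˡ h≈) d)) (⊎ₕ-regroup h₁ h₂ hF H≈ h≈)
  safe = proj₁ inner
  post : ∀ s' ĥ → ⟦ c ⟧ s , H ⇓ ok s' ĥ → WithFrame s' ĥ hF (Q ∗ R)
  post s' ĥ ⇓ok with proj₂ inner s' ĥ ⇓ok
  ... | h₁' , fin₁' , h₁'⊥h₂hF , ĥ≈ , q =
    h₁' ⊎ₕ h₂ , Finite-⊎ₕ fin₁' (Finite-⊑ₕ h₂⊑h fin) , ⊥ₕ-⊎ˡ (⊥ₕ-⊎ʳ⁻ʳ {b = h₂} h₁'⊥h₂hF) (⊑ₕ-⊥ₕ h₂⊑h d) ,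
    ≈ₕ-trans ĥ≈ (≈ₕ-sym (⊎ₕ-assoc h₁' h₂ hF)) ,
    h₁' , h₂ , ⊥ₕ-⊎ʳ⁻ˡ {c = hF} h₁'⊥h₂hF , ≈ₕ-refl , q ,
    ⊨-resp-agree R (λ z z∈R → sym (⇓-unmodified ⇓ok z (λ z∈c → R-unmod z z∈c z∈R))) r

⊨SL-exists : ∀ {P c Q} x → ⊨SL⟨ P ⟩ c ⟨ Q ⟩ → ¬ (x ∈FVc c) → ⊨SL⟨ ∃ₐ x P ⟩ c ⟨ ∃ₐ x Q ⟩
⊨SL-exists {c = c} {Q} x valid x∉c s h fin (w , p) hF H d H≈ = safe , post
  where
  t = s [ x ↦ₛ w ]
  s≗t-on-c : ∀ z → z ∈FVc c → s z ≡ t z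
  s≗t-on-c z z∈c = sym (updₛ-other s x w z (λ { refl → x∉c z∈c }))
  inner = valid t h fin p hF H d H≈
  safe : ¬ (⟦ c ⟧ s , H ⇓ abort)
  safe ⇓abort = proj₁ inner (⇓abort-agree s≗t-on-c ⇓abort)
  post : ∀ s' ĥ → ⟦ c ⟧ s , H ⇓ ok s' ĥ → WithFrame s' ĥ hF (∃ₐ x Q)
  post s' ĥ ⇓ok with ⇓ok-agree s≗t-on-c ⇓ok
  ... | t' , ⇓ok' , s'≗t'-on-mod with proj₂ inner t' ĥ ⇓ok'
  ...   | h' , fin' , d' , ĥ≈ , q = h' , fin' , d' , ĥ≈ , t' x , ⊨-resp-agree Q t'≗ q
    where
    t'≗ : ∀ z → z ∈FV Q → t' z ≡ (s' [ x ↦ₛ t' x ]) z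
    t'≗ z _ with z ℕ.≟ x
    ... | yes z≡x = cong t' z≡x
    ... | no z≢x with z ∈mod? c
    ...   | yes z∈c = sym (s'≗t'-on-mod z z∈c)
    ...   | no z∉c = begin
      t' z  ≡⟨ ⇓-unmodified ⇓ok' z z∉c ⟩
      t z   ≡⟨ updₛ-other s x w z z≢x ⟩
      s z   ≡⟨ ⇓-unmodified ⇓ok z z∉c ⟨
      s' z  ∎
      where open ≡-Reasoning

⊨SL-disj : ∀ {P₁ P₂ c Q₁ Q₂} → ⊨SL⟨ P₁ ⟩ c ⟨ Q₁ ⟩ → ⊨SL⟨ P₂ ⟩ c ⟨ Q₂ ⟩ → ⊨SL⟨ P₁ ∨ₐ P₂ ⟩ c ⟨ Q₁ ∨ₐ Q₂ ⟩
⊨SL-disj valid₁ valid₂ s h fin (inj₁ p₁) = ⊨SL-post (λ _ _ _ → inj₁) valid₁ s h fin p₁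
⊨SL-disj valid₁ valid₂ s h fin (inj₂ p₂) = ⊨SL-post (λ _ _ _ → inj₂) valid₂ s h fin p₂

⊨SL-conj : ∀ {P₁ P₂ c Q₁ Q₂} → ⊨SL⟨ P₁ ⟩ c ⟨ Q₁ ⟩ → ⊨SL⟨ P₂ ⟩ c ⟨ Q₂ ⟩ → ⊨SL⟨ P₁ ∧ₐ P₂ ⟩ c ⟨ Q₁ ∧ₐ Q₂ ⟩
⊨SL-conj {c = c} {Q₁} {Q₂} valid₁ valid₂ s h fin (p₁ , p₂) hF H d H≈ = proj₁ inner₁ , post
  where
  inner₁ = valid₁ s h fin p₁ hF H d H≈
  inner₂ = valid₂ s h fin p₂ hF H d H≈
  post : ∀ s' ĥ → ⟦ c ⟧ s , H ⇓ ok s' ĥ → WithFrame s' ĥ hF (Q₁ ∧ₐ Q₂)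
  post s' ĥ ⇓ok with proj₂ inner₁ s' ĥ ⇓ok | proj₂ inner₂ s' ĥ ⇓ok
  ... | h₁' , fin₁ , d₁ , ĥ≈₁ , q₁ | h₂' , _ , d₂ , ĥ≈₂ , q₂ =
    h₁' , fin₁ , d₁ , ĥ≈₁ , q₁ , ⊨-resp-≈ₕ Q₂ (⊎ₕ-cancelʳ d₂ d₁ (≈ₕ-trans (≈ₕ-sym ĥ≈₂) ĥ≈₁)) q₂

sound : ∀ {P c Q} → ⊢SL⟨ P ⟩ c ⟨ Q ⟩ → ⊨SL⟨ P ⟩ c ⟨ Q ⟩
sound (sl-assign {x} {e} {Q}) = ⊨SL-assign x e Q
sound (sl-lookup {x} {e} {Q} {v} v∉e v∈Q) = ⊨SL-lookup x e Q v v∉e v∈Q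
sound (sl-mutate {e} {e'} {Q}) = ⊨SL-mutate e e' Q
sound (sl-cons {x} {es} {Q} {v} v∉es v∉Q) = ⊨SL-cons x es Q v v∉es v∉Q
sound (sl-dispose {e} {Q}) = ⊨SL-dispose e Q
sound (sl-conseq P⊨P' der Q'⊨Q) = ⊨SL-post Q'⊨Q (⊨SL-pre P⊨P' (sound der))
sound (sl-frame {R = R} der R-unmod) = ⊨SL-frame R (sound der) R-unmod
sound (sl-exists {x = x} der x∉c) = ⊨SL-exists x (sound der) x∉c
sound (sl-disj der₁ der₂) = ⊨SL-disj (sound der₁) (sound der₂)
sound (sl-conj der₁ der₂) = ⊨SL-conj (sound der₁) (sound der₂)

-- Resource invariants

emp-precise : Precise emp
emp-precise s h h₁ h₂ fin _ _ h₁-empty h₂-empty l = trans (h₁-empty l) (sym (h₂-empty l))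

∗-precise : ∀ {R S} → Precise R → Precise S → Precise (R ∗ S)
∗-precise R-precise S-precise s h h₁ h₂ fin h₁⊑h h₂⊑h
  (a₁ , b₁ , a₁⊥b₁ , h₁≈ , r₁ , q₁) (a₂ , b₂ , a₂⊥b₂ , h₂≈ , r₂ , q₂) =
  ≈ₕ-trans h₁≈ (≈ₕ-trans (⊎ₕ-cong a₁≈a₂ b₁≈b₂) (≈ₕ-sym h₂≈))
  where
  a₁≈a₂ = R-precise s h a₁ a₂ fin (⊑ₕ-trans (split-⊑ˡ h₁≈) h₁⊑h) (⊑ₕ-trans (split-⊑ˡ h₂≈) h₂⊑h) r₁ r₂
  b₁≈b₂ = S-precise s h b₁ b₂ fin
            (⊑ₕ-trans (split-⊑ʳ a₁⊥b₁ h₁≈) h₁⊑h) (⊑ₕ-trans (split-⊑ʳ a₂⊥b₂ h₂≈) h₂⊑h) q₁ q₂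

⊛-precise : ∀ {n} (Γ : ResCtx n) D → Precise (⊛ Γ D)
⊛-precise [] [] = emp-precise
⊛-precise (d ∷ Γ) (inside ∷ D) = ∗-precise (ResDecl.precise d) (⊛-precise Γ D)
⊛-precise (d ∷ Γ) (outside ∷ D) = ⊛-precise Γ D

FV-⊛⇒PVΓ : ∀ {n} (Γ : ResCtx n) D x → x ∈FV ⊛ Γ D → PVΓ Γ x
FV-⊛⇒PVΓ [] [] x ()
FV-⊛⇒PVΓ (d ∷ Γ) (inside ∷ D) x (inj₁ x∈R) = zero , ResDecl.fv⊆X d x x∈R
FV-⊛⇒PVΓ (d ∷ Γ) (inside ∷ D) x (inj₂ x∈⊛) = let (r , x∈PVr) = FV-⊛⇒PVΓ Γ D x x∈⊛ in suc r , x∈PVr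
FV-⊛⇒PVΓ (d ∷ Γ) (outside ∷ D) x x∈⊛ = let (r , x∈PVr) = FV-⊛⇒PVΓ Γ D x x∈⊛ in suc r , x∈PVr

precise-split-unique : ∀ {R s h hG h₀ hG₀} → Precise R → Finite h → Finite hG → h ⊥ₕ hG → h₀ ⊥ₕ hG₀ →
  s , hG ⊨ R → s , hG₀ ⊨ R → (h ⊎ₕ hG) ≈ₕ (h₀ ⊎ₕ hG₀) → h ≈ₕ h₀
precise-split-unique {s = s} {h} {hG} {h₀} {hG₀} R-precise fin finG h⊥hG h₀⊥hG₀ r r₀ split≈ =
  ⊎ₕ-cancelʳ h⊥hG (⊥ₕ-respʳ (≈ₕ-sym hG≈hG₀) h₀⊥hG₀) (≈ₕ-trans split≈ (⊎ₕ-congˡ h₀ (≈ₕ-sym hG≈hG₀)))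
  where
  hG≈hG₀ : hG ≈ₕ hG₀
  hG≈hG₀ = R-precise s (h ⊎ₕ hG) hG hG₀ (Finite-⊎ₕ fin finG) (⊑ₕ-⊎ʳ h hG h⊥hG)
             (⊑ₕ-trans (⊑ₕ-⊎ʳ h₀ hG₀ h₀⊥hG₀) (≈ₕ⇒⊑ₕ (≈ₕ-sym split≈))) r r₀

-- Safety

module _ {m} (Γ : ResCtx m) (Q : Assert) (A : VarSet) where

  SafeAfter : ℕ → Cmd → Store → Heap → RConf m → Set
  SafeAfter n C s ĥ ρ = Σ Heap λ h → Σ Heap λ hG →
    (h ⊥ₕ hG) × (ĥ ≈ₕ (h ⊎ₕ hG)) × (s , hG ⊨ ⊛ Γ (RConf.D ρ)) × Safe n C s h ρ Γ Q A

  -- By precision the environment cannot touch the local heap h.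
  EnvStep⇒SafeAfter : ∀ {n C s h hG ρ C' s' ĥ ρ'} → Finite h → Finite hG → h ⊥ₕ hG →
    s , hG ⊨ ⊛ Γ (RConf.D ρ) → (∀ t ρ'' → (∀ x → A x → s x ≡ t x) → Safe n C t h ρ'' Γ Q A) →
    EnvStep A Γ C s (h ⊎ₕ hG) ρ C' s' ĥ ρ' → SafeAfter n C' s' ĥ ρ'
  EnvStep⇒SafeAfter {h = h} {ρ = ρ} fin finG h⊥hG inv safe
    (env {hG = hG₀} {hG' = hG'} (s≗s' , _) h₀⊥hG₀ h₀⊥hG' _ _ inv₀ inv' split≈ ĥ≈) =
    h , hG' , ⊥ₕ-respˡ (≈ₕ-sym h≈h₀) h₀⊥hG' , ≈ₕ-trans ĥ≈ (⊎ₕ-congʳ hG' (≈ₕ-sym h≈h₀)) , inv' ,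
    safe _ _ (λ x x∈A → s≗s' x (inj₁ x∈A))
    where
    h≈h₀ = precise-split-unique (⊛-precise Γ (RConf.D ρ)) fin finG h⊥hG h₀⊥hG₀ inv inv₀ split≈

  skip-safe : (∀ x → x ∈FV Q → A x) → ∀ n s h ρ → Finite h → s , h ⊨ Q → Safe n skip s h ρ Γ Q A
  skip-safe Q⊆A zero s h ρ fin q = _
  skip-safe Q⊆A (suc n) s h ρ fin q = (λ _ → q) , (λ ()) , (λ _ ()) , step
    where
    step : ∀ hG → Finite hG → h ⊥ₕ hG → s , hG ⊨ ⊛ Γ (RConf.D ρ) →
      ∀ C' s' ĥ ρ' → Step A Γ skip s (h ⊎ₕ hG) ρ C' s' ĥ ρ' → SafeAfter n C' s' ĥ ρ'
    step hG finG h⊥hG inv C' s' ĥ ρ' (inj₂ env-step) =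
      EnvStep⇒SafeAfter fin finG h⊥hG inv
        (λ t ρ'' s≗t → skip-safe Q⊆A n t h ρ'' fin (⊨-resp-agree Q (λ z z∈Q → s≗t z (Q⊆A z z∈Q)) q))
        env-step

  basic-safe : ∀ {P c} → ⊢SL⟨ P ⟩ c ⟨ Q ⟩ → (∀ x → (x ∈FV P) ⊎ (x ∈FVc c) ⊎ (x ∈FV Q) → A x) →
    (∀ x → x ∈mod c → ¬ PVΓ Γ x) → ∀ n s h ρ → Finite h → s , h ⊨ P → Safe n (basic c) s h ρ Γ Q A
  basic-safe der FV⊆A mod∉PV zero s h ρ fin p = _
  basic-safe {P} {c} der FV⊆A mod∉PV (suc n) s h ρ fin p =
    (λ ()) , no-abort , (λ x x∈c (r , _ , x∈PVr) → mod∉PV x x∈c (r , x∈PVr)) , step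
    where
    no-abort : ¬ (basic c ,⟨ s , h , ρ ⟩→p-abort)
    no-abort (p-abort ⇓abort) =
      proj₁ (sound der s h fin p emptyHeap h (⊥ₕ-emptyʳ h) (≈ₕ-sym (⊎ₕ-identityʳ h))) ⇓abort
    step : ∀ hG → Finite hG → h ⊥ₕ hG → s , hG ⊨ ⊛ Γ (RConf.D ρ) →
      ∀ C' s' ĥ ρ' → Step A Γ (basic c) s (h ⊎ₕ hG) ρ C' s' ĥ ρ' → SafeAfter n C' s' ĥ ρ'
    step hG finG h⊥hG inv C' s' ĥ ρ' (inj₁ (p-basic ⇓ok))
      with proj₂ (sound der s h fin p hG (h ⊎ₕ hG) h⊥hG ≈ₕ-refl) s' ĥ ⇓ok
    ... | h' , fin' , h'⊥hG , ĥ≈ , q =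
      h' , hG , h'⊥hG , ĥ≈ ,
      ⊨-resp-agree (⊛ Γ (RConf.D ρ))
        (λ z z∈⊛ → sym (⇓-unmodified ⇓ok z (λ z∈c → mod∉PV z z∈c (FV-⊛⇒PVΓ Γ (RConf.D ρ) z z∈⊛)))) inv ,
      skip-safe (λ x x∈Q → FV⊆A x (inj₂ (inj₂ x∈Q))) n s' h' ρ fin' q
    step hG finG h⊥hG inv C' s' ĥ ρ' (inj₂ env-step) =
      EnvStep⇒SafeAfter fin finG h⊥hG inv
        (λ t ρ'' s≗t → basic-safe der FV⊆A mod∉PV n t h ρ'' fin
                          (⊨-resp-agree P (λ z z∈P → s≗t z (FV⊆A z (inj₁ z∈P))) p))
        env-step

proposition11 : ∀ {m} (c : BCmd) (P Q : Assert) (Γ : ResCtx m)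
    (s : Store) (h : Heap) (ρ : RConf m) (A : VarSet) →
    Finite h →
    ⊢SL⟨ P ⟩ c ⟨ Q ⟩ →
    (∀ x → (x ∈FV P) ⊎ (x ∈FVc c) ⊎ (x ∈FV Q) → A x) →
    s , h ⊨ P →
    (∀ x → x ∈mod c → ¬ PVΓ Γ x) →
    ∀ n → Safe n (basic c) s h ρ Γ Q A
proposition11 c P Q Γ s h ρ A fin der FV⊆A p mod∉PV n = basic-safe Γ Q A der FV⊆A mod∉PV n s h ρ fin p
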